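{- Let $n$, $d$ and $k$ be positive integers such that $d\ge 3$ (and $d\le n/2$). If $C$ is an identifying code in $C_n(1,d-1,d)$ with $k$ codewords, then there exists an identifying code in the infinite triangular grid $\mathcal{T}$ with density $k/n$. Analogously, a locating-dominating (respectively self-identifying) code in $C_n(1,d-1,d)$ with $k$ codewords yields a locating-dominating (respectively self-identifying) code in $\mathcal{T}$ with density $k/n$.
   Context: All graphs are simple and undirected. For a graph $G=(V,E)$ and $u\in V$, $N[u]=\{u\}\cup\{v: uv\in E\}$. A code is a nonempty $C\subseteq V$, and $I(C;u)=N[u]\cap C$. $C$ is dominating if $I(C;u)\neq\emptyset$ for all $u$; identifying if dominating and $I(C;u)\neq I(C;v)$ for all distinct $u,v\in V$; locating-dominating if dominating and $I(C;u)\neq I(C;v)$ for all distinct $u,v\in V\setminus C$; self-identifying if $I(C;u)\setminus I(C;v)\neq\emptyset$ for all distinct $u,v\in V$. For positive integers $n$ and $d_1,\dots,d_k\le n/2$, the circulant graph $C_n(d_1,\dots,d_k)$ has vertex set $\mathbb{Z}_n$, and the open neighbourhood of $u$ is $\{u\pm d_1,\dots,u\pm d_k\}$ modulo $n$. The infinite triangular grid $\mathcal{T}$ has vertex set $\mathbb{Z}^2$ and $N[(x,y)]=\{(x',y'): |x-x'|+|y-y'|\le1\}\cup\{(x+1,y+1),(x-1,y-1)\}$. With $Q_m=\{(x,y)\in\mathbb{Z}^2:|x|\le m,|y|\le m\}$, the density of $C\subseteq\mathbb{Z}^2$ is $\limsup_{m\to\infty}|C\cap Q_m|/|Q_m|$.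 -}

module Defs where

open import Data.Nat as ℕ using (ℕ; zero; suc; NonZero)
open import Data.Integer as ℤ using (ℤ; +_; -_; ∣_∣)
open import Data.Integer.Divisibility using () renaming (_∣_ to _∣ℤ_)
open import Data.Rational as ℚ using (ℚ; _/_; 0ℚ)
open import Data.Fin using (Fin; toℕ)
open import Data.List using (List; []; _∷_; map; upTo; allFin; concatMap)
open import Data.Nat.ListAction using (sum)
open import Data.List.Membership.Propositional using (_∈_)
open import Data.Bool using (Bool; true; false; if_then_else_)
open import Data.Product using (Σ; ∃; _×_; _,_)
open import Data.Sum using (_⊎_)
open import Relation.Nullary using (¬_)
open import Relation.Binary.PropositionalEquality using (_≡_; _≢_)

-- A graph is given by its vertex type and its closed neighbourhoods:
-- N u v  means  v ∈ N[u].

record Graph : Set₁ where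
  field
    V : Set
    N : V → V → Set
open Graph public

module _ (G : Graph) (C : V G → Bool) where

  I : V G → V G → Set
  I u w = N G u w × C w ≡ true

  Nonempty : Set
  Nonempty = ∃ λ v → C v ≡ true

  Dominating : Set
  Dominating = ∀ u → ∃ λ w → I u w

  SameI : V G → V G → Set
  SameI u v = ∀ w → (I u w → I v w) × (I v w → I u w)

  Identifying : Set
  Identifying = Nonempty × Dominating × (∀ u v → u ≢ v → ¬ SameI u v)

  LocatingDominating : Set
  LocatingDominating = Nonempty × Dominating ×
    (∀ u v → C u ≡ false → C v ≡ false → u ≢ v → ¬ SameI u v)

  SelfIdentifying : Set
  SelfIdentifying = Nonempty ×
    (∀ u v → u ≢ v → ∃ λ w → I u w × ¬ I v w)

Circulant : (n : ℕ) → List ℕ → Graph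
Circulant n ds = record
  { V = Fin n
  ; N = λ u v → u ≡ v ⊎ (∃ λ s → s ∈ ds ×
        ((+ n ∣ℤ (+ toℕ v ℤ.- (+ toℕ u ℤ.+ + s)))
         ⊎ (+ n ∣ℤ (+ toℕ v ℤ.- (+ toℕ u ℤ.- + s)))))
  }

count : {n : ℕ} → (Fin n → Bool) → ℕ
count {n} C = sum (map (λ i → if C i then 1 else 0) (allFin n))

Triangular : Graph
Triangular = record
  { V = ℤ × ℤ
  ; N = λ { (x , y) (x' , y') →
        (∣ x ℤ.- x' ∣ ℕ.+ ∣ y ℤ.- y' ∣ ℕ.≤ 1)
        ⊎ ((x' , y') ≡ (x ℤ.+ ℤ.1ℤ , y ℤ.+ ℤ.1ℤ))
        ⊎ ((x' , y') ≡ (x ℤ.- ℤ.1ℤ , y ℤ.- ℤ.1ℤ)) }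
  }

range : ℕ → List ℤ
range m = map (λ i → + i ℤ.- + m) (upTo (suc (2 ℕ.* m)))

countQ : (ℤ × ℤ → Bool) → ℕ → ℕ
countQ C m = sum (concatMap (λ x → map (λ y → if C (x , y) then 1 else 0) (range m)) (range m))

-- |Q_m| = (2m+1)², written as suc of something so that NonZero is evident
sizeQ-1 : ℕ → ℕ
sizeQ-1 m = (2 ℕ.* m) ℕ.* (2 ℕ.* m) ℕ.+ 4 ℕ.* m

ratio : (ℤ × ℤ → Bool) → ℕ → ℚ
ratio C m = (+ countQ C m) / suc (sizeQ-1 m)

LimsupEq : (ℕ → ℚ) → ℚ → Set
LimsupEq a q = ∀ (ε : ℚ) → 0ℚ ℚ.< ε →
  (∃ λ M → ∀ m → M ℕ.≤ m → a m ℚ.≤ q ℚ.+ ε) ×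
  (∀ M → ∃ λ m → M ℕ.≤ m × q ℚ.- ε ℚ.< a m)

HasDensity : (ℤ × ℤ → Bool) → ℚ → Set
HasDensity C q = LimsupEq (ratio C) q

module Submission where

-- The map φ (x , y) = (d - 1) x + y mod n sends the closed neighbourhood of every point of the
-- triangular grid onto the closed neighbourhood of its image in C_n(1, d - 1, d), because the seven
-- steps of the grid go to the offsets 0, ±1, ±(d - 1), ±d. Hence the pullback D = C ∘ φ is dominating
-- when C is, and two points with distinct images are separated by D because their images are
-- separated by C. Two distinct points p, q with the same image are separated by a codeword near p:
-- the offsets are pairwise incongruent mod n except d ≡ -d when n = 2d, and in that case the
-- codeword can be moved to the opposite diagonal neighbour of p, which is at distance 3 from q.
-- Finally each row of D is an n-periodic sequence with k ones per period, so every row of the square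
-- Q_m carries (2m + 1) k / n codewords up to an error n, and D has density k / n.

open import Defs
open import Data.Nat as ℕ using (ℕ; zero; suc; NonZero; z≤n; s≤s; _≤_; _<_; _*_; _∸_)
import Data.Nat.Properties as ℕP
open import Data.Nat.Divisibility using (∣⇒≤) renaming (_∣_ to _∣ℕ_)
open import Data.Nat.DivMod using (m≡m%n+[m/n]*n; m%n<n)
import Data.Nat.Tactic.RingSolver as NS
open import Data.Integer as ℤ using (ℤ; +_; -[1+_]; -_; 0ℤ; 1ℤ; ∣_∣)
import Data.Integer.Properties as ℤP
open import Data.Integer.Divisibility.Signed using (_∣_; divides; ∣⇒∣ᵤ; ∣ᵤ⇒∣; ∣m⇒∣-m; ∣m∣n⇒∣m+n; ∣m∣n⇒∣m-n)
open import Data.Integer.DivMod using (_%ℕ_; _/ℕ_; n%ℕd<d; a≡a%ℕn+[a/ℕn]*n)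
open import Data.Integer.Tactic.RingSolver using (solve-∀)
open import Data.Rational as ℚ using (ℚ; mkℚ; _/_; toℚᵘ)
import Data.Rational.Properties as ℚP
open import Data.Rational.Unnormalised as ℚᵘ using (ℚᵘ; mkℚᵘ; *≤*; *<*)
import Data.Rational.Unnormalised.Properties as ℚᵘP
open import Data.Fin as Fin using (Fin; toℕ; fromℕ<)
import Data.Fin.Properties as FinP
open import Data.Bool using (Bool; true; false; if_then_else_)
open import Data.List using (List; _∷_; []; map; length; concatMap; applyUpTo; upTo; tabulate)
import Data.List.Properties as ListP
open import Data.Nat.ListAction using (sum)
open import Data.Nat.ListAction.Properties using (sum-++)
open import Data.List.Membership.Propositional using (_∈_)
open import Data.List.Relation.Unary.Any using (here; there)
open import Data.Product using (∃; _×_; _,_; proj₁; proj₂)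
open import Data.Sum as Sum using (_⊎_; inj₁; inj₂)
open import Function using (_∘_)
open import Data.Product.Properties using (≡-dec)
open import Algebra.Bundles using (AbelianGroup)
open import Algebra.Properties.Group (AbelianGroup.group ℤP.+-0-abelianGroup) using () renaming (∙-cancelʳ to +-cancelʳ)
open import Relation.Nullary using (¬_; Dec; contradiction; yes; no)
open import Relation.Nullary.Decidable using (_⊎-dec_)
open import Relation.Binary.Definitions using (DecidableEquality; tri<; tri≈; tri>)
open import Relation.Binary.PropositionalEquality
open import Relation.Binary.Bundles using (Setoid)

infix 4 _≡_[mod_]

record _≡_[mod_] (a b : ℤ) (n : ℕ) : Set where
  constructor by-divisibility
  field divides-difference : + n ∣ a ℤ.- b
open _≡_[mod_]

module _ {n : ℕ} where

  ≡⇒≡-mod : ∀ {a b} → a ≡ b → a ≡ b [mod n ]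
  ≡⇒≡-mod {a} refl = by-divisibility (divides 0ℤ (ℤP.+-inverseʳ a))

  ≡-mod-sym : ∀ {a b} → a ≡ b [mod n ] → b ≡ a [mod n ]
  ≡-mod-sym {a} {b} (by-divisibility n∣a-b) = by-divisibility (subst (+ n ∣_) (negate-difference a b) (∣m⇒∣-m n∣a-b))
    where
    negate-difference : ∀ a b → - (a ℤ.- b) ≡ b ℤ.- a
    negate-difference = solve-∀

  ≡-mod-trans : ∀ {a b c} → a ≡ b [mod n ] → b ≡ c [mod n ] → a ≡ c [mod n ]
  ≡-mod-trans {a} {b} {c} (by-divisibility n∣a-b) (by-divisibility n∣b-c) =
    by-divisibility (subst (+ n ∣_) (ℤP.+-minus-telescope a b c) (∣m∣n⇒∣m+n n∣a-b n∣b-c))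

  ≡-mod-+ : ∀ {a b c d} → a ≡ b [mod n ] → c ≡ d [mod n ] → a ℤ.+ c ≡ b ℤ.+ d [mod n ]
  ≡-mod-+ {a} {b} {c} {d} (by-divisibility n∣a-b) (by-divisibility n∣c-d) =
    by-divisibility (subst (+ n ∣_) (regroup a b c d) (∣m∣n⇒∣m+n n∣a-b n∣c-d))
    where
    regroup : ∀ a b c d → (a ℤ.- b) ℤ.+ (c ℤ.- d) ≡ (a ℤ.+ c) ℤ.- (b ℤ.+ d)
    regroup = solve-∀

  ≡-mod-cancelˡ : ∀ {a b c d} → a ≡ b [mod n ] → a ℤ.+ c ≡ b ℤ.+ d [mod n ] → c ≡ d [mod n ]
  ≡-mod-cancelˡ {a} {b} {c} {d} (by-divisibility n∣a-b) (by-divisibility n∣ac-bd) =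
    by-divisibility (subst (+ n ∣_) (regroup a b c d) (∣m∣n⇒∣m-n n∣ac-bd n∣a-b))
    where
    regroup : ∀ a b c d → ((a ℤ.+ c) ℤ.- (b ℤ.+ d)) ℤ.- (a ℤ.- b) ≡ c ℤ.- d
    regroup = solve-∀

  modulus≡0 : + n ≡ 0ℤ [mod n ]
  modulus≡0 = by-divisibility (divides 1ℤ (trans (ℤP.+-identityʳ (+ n)) (sym (ℤP.*-identityˡ (+ n)))))

  minus≡-mod-half : ∀ {d} → n ≡ d ℕ.+ d → - + d ≡ + d [mod n ]
  minus≡-mod-half {d} n≡d+d = by-divisibility (divides (- 1ℤ) (subst (λ m → - + d ℤ.- + d ≡ - 1ℤ ℤ.* + m) (sym n≡d+d) (double (+ d))))
    where
    double : ∀ a → - a ℤ.- a ≡ - 1ℤ ℤ.* (a ℤ.+ a)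
    double = solve-∀

≡-mod-setoid : ℕ → Setoid _ _
≡-mod-setoid n = record
  { Carrier = ℤ
  ; _≈_ = _≡_[mod n ]
  ; isEquivalence = record { refl = ≡⇒≡-mod refl ; sym = ≡-mod-sym ; trans = ≡-mod-trans }
  }

module ≡-mod-Reasoning (n : ℕ) where
  open import Relation.Binary.Reasoning.Setoid (≡-mod-setoid n) public

multiple-below : ∀ {n m} → n ∣ℕ m → m ≤ n → m ≡ 0 ⊎ m ≡ n
multiple-below {m = zero} _ _ = inj₁ refl
multiple-below {m = suc m} n∣m m≤n = inj₂ (ℕP.≤-antisym m≤n (∣⇒≤ n∣m))

≡-mod-ℕ-ordered : ∀ {n A B} → B ≤ A → A ≤ n → + A ≡ + B [mod n ] → A ≡ B ⊎ (A ≡ n × B ≡ 0)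
≡-mod-ℕ-ordered {n} {A} {B} B≤A A≤n A≡B with multiple-below (∣⇒∣ᵤ (subst (+ n ∣_) difference (divides-difference A≡B))) (ℕP.≤-trans (ℕP.m∸n≤m A B) A≤n)
  where
  difference : + A ℤ.- + B ≡ + (A ∸ B)
  difference = trans (ℤP.m-n≡m⊖n A B) (ℤP.⊖-≥ B≤A)
... | inj₁ A∸B≡0 = inj₁ (ℕP.≤-antisym (ℕP.m∸n≡0⇒m≤n A∸B≡0) B≤A)
... | inj₂ A∸B≡n = inj₂ (A≡n , B≡0)
  where
  A≡n : A ≡ n
  A≡n = ℕP.≤-antisym A≤n (subst (_≤ A) A∸B≡n (ℕP.m∸n≤m A B))
  B≡0 : B ≡ 0
  B≡0 = trans (sym (ℕP.m∸[m∸n]≡n B≤A)) (trans (cong₂ _∸_ A≡n A∸B≡n) (ℕP.n∸n≡0 n))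

≡-mod-ℕ : ∀ {n A B} → A ≤ n → B ≤ n → + A ≡ + B [mod n ] →
  A ≡ B ⊎ (A ≡ n × B ≡ 0) ⊎ (B ≡ n × A ≡ 0)
≡-mod-ℕ {A = A} {B} A≤n B≤n A≡B with ℕP.≤-total B A
... | inj₁ B≤A = Sum.map₂ inj₁ (≡-mod-ℕ-ordered B≤A A≤n A≡B)
... | inj₂ A≤B = Sum.map sym inj₂ (≡-mod-ℕ-ordered A≤B B≤n (≡-mod-sym A≡B))

≡-mod-ℕ-< : ∀ {n A B} → A < n → B < n → + A ≡ + B [mod n ] → A ≡ B
≡-mod-ℕ-< A<n B<n A≡B with ≡-mod-ℕ (ℕP.<⇒≤ A<n) (ℕP.<⇒≤ B<n) A≡B
... | inj₁ A≡B = A≡B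
... | inj₂ (inj₁ (A≡n , _)) = contradiction A≡n (ℕP.<⇒≢ A<n)
... | inj₂ (inj₂ (B≡n , _)) = contradiction B≡n (ℕP.<⇒≢ B<n)

module _ (n : ℕ) .{{_ : NonZero n}} where

  residue : ℤ → Fin n
  residue a = fromℕ< (n%ℕd<d a n)

  residue-≡-mod : ∀ a → + toℕ (residue a) ≡ a [mod n ]
  residue-≡-mod a = by-divisibility (divides (- q) (begin
      + toℕ (residue a) ℤ.- a        ≡⟨ cong (λ r → + r ℤ.- a) (FinP.toℕ-fromℕ< (n%ℕd<d a n)) ⟩
      + r ℤ.- a                      ≡⟨ cong (λ b → + r ℤ.- b) (a≡a%ℕn+[a/ℕn]*n a n) ⟩
      + r ℤ.- (+ r ℤ.+ q ℤ.* + n)    ≡⟨ cancel (+ r) q (+ n) ⟩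
      - q ℤ.* + n                    ∎))
    where
    open ≡-Reasoning
    r : ℕ
    r = a %ℕ n
    q : ℤ
    q = a /ℕ n
    cancel : ∀ r q n → r ℤ.- (r ℤ.+ q ℤ.* n) ≡ - q ℤ.* n
    cancel = solve-∀

  residue-cong : ∀ {a b} → a ≡ b [mod n ] → residue a ≡ residue b
  residue-cong {a} {b} a≡b = FinP.toℕ-injective (≡-mod-ℕ-< (FinP.toℕ<n (residue a)) (FinP.toℕ<n (residue b)) (begin
      + toℕ (residue a)  ≈⟨ residue-≡-mod a ⟩
      a                  ≈⟨ a≡b ⟩
      b                  ≈⟨ ≡-mod-sym (residue-≡-mod b) ⟩
      + toℕ (residue b)  ∎))
    where open ≡-mod-Reasoning n

  residue-≡⇒≡-mod : ∀ {a b} → residue a ≡ residue b → a ≡ b [mod n ]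
  residue-≡⇒≡-mod {a} {b} eq = begin
      a                  ≈⟨ ≡-mod-sym (residue-≡-mod a) ⟩
      + toℕ (residue a)  ≡⟨ cong (+_ ∘ toℕ) eq ⟩
      + toℕ (residue b)  ≈⟨ residue-≡-mod b ⟩
      b                  ∎
    where open ≡-mod-Reasoning n

  residue-toℕ : ∀ v → residue (+ toℕ v) ≡ v
  residue-toℕ v = FinP.toℕ-injective (≡-mod-ℕ-< (FinP.toℕ<n (residue (+ toℕ v))) (FinP.toℕ<n v) (residue-≡-mod (+ toℕ v)))

Distinguishes : (G : Graph) → (V G → Bool) → V G → V G → Set
Distinguishes G C u v = ∃ λ w → I G C u w × ¬ I G C v w

module _ {G : Graph} {C : V G → Bool} where

  distinguishes⇒¬SameI : ∀ {u v} → Distinguishes G C u v → ¬ SameI G C u v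
  distinguishes⇒¬SameI (w , u∼w , ¬v∼w) same = ¬v∼w (proj₁ (same w) u∼w)

  self-identifying⇒dominating : (∀ u → ∃ λ v → u ≢ v) → SelfIdentifying G C → Dominating G C
  self-identifying⇒dominating other (_ , distinguish) u with distinguish u (proj₁ (other u)) (proj₂ (other u))
  ... | w , u∼w , _ = w , u∼w

module Pullback {G H : Graph} (φ : V G → V H)
  (φ-surjective : ∀ v → ∃ λ p → φ p ≡ v)
  (φ-preserves : ∀ {p q} → N G p q → N H (φ p) (φ q))
  (φ-lifts : ∀ {p w} → N H (φ p) w → ∃ λ q → N G p q × φ q ≡ w)
  (C : V H → Bool) where

  D : V G → Bool
  D = C ∘ φ

  I-preserved : ∀ {p q} → I G D p q → I H C (φ p) (φ q)
  I-preserved (p∼q , q∈D) = φ-preserves p∼q , q∈D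

  I-lifts : ∀ {p w} → I H C (φ p) w → ∃ λ q → I G D p q × φ q ≡ w
  I-lifts (φp∼w , w∈C) with φ-lifts φp∼w
  ... | q , p∼q , refl = q , (p∼q , w∈C) , refl

  nonempty-pullback : Nonempty H C → Nonempty G D
  nonempty-pullback (v , v∈C) with φ-surjective v
  ... | p , refl = p , v∈C

  dominating-pullback : Dominating H C → Dominating G D
  dominating-pullback dominating p with I-lifts (proj₂ (dominating (φ p)))
  ... | q , p∼q , _ = q , p∼q

  ⊆-preserved : ∀ {p q w} → (∀ r → I G D p r → I G D q r) → I H C (φ p) w → I H C (φ q) w
  ⊆-preserved p⊆q φp∼w with I-lifts φp∼w
  ... | r , p∼r , refl = I-preserved (p⊆q r p∼r)

  SameI-preserved : ∀ {p q} → SameI G D p q → SameI H C (φ p) (φ q)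
  SameI-preserved same w = ⊆-preserved (proj₁ ∘ same) , ⊆-preserved (proj₂ ∘ same)

  distinguishes-lifts : ∀ {p q} → Distinguishes H C (φ p) (φ q) → Distinguishes G D p q
  distinguishes-lifts (w , φp∼w , ¬φq∼w) with I-lifts φp∼w
  ... | r , p∼r , refl = r , p∼r , ¬φq∼w ∘ I-preserved

  FibresDistinguished : Set
  FibresDistinguished = ∀ {p q} → p ≢ q → φ p ≡ φ q → Distinguishes G D p q

  module _ (_≟_ : DecidableEquality (V H)) (fibres-distinguished : Dominating H C → FibresDistinguished) where

    identifying-pullback : Identifying H C → Identifying G D
    identifying-pullback (nonempty , dominating , separating) =
      nonempty-pullback nonempty , dominating-pullback dominating , separating′
      where
      separating′ : ∀ p q → p ≢ q → ¬ SameI G D p q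
      separating′ p q p≢q with φ p ≟ φ q
      ... | yes φp≡φq = distinguishes⇒¬SameI {G = G} {C = D} (fibres-distinguished dominating p≢q φp≡φq)
      ... | no φp≢φq = separating _ _ φp≢φq ∘ SameI-preserved

    locating-dominating-pullback : LocatingDominating H C → LocatingDominating G D
    locating-dominating-pullback (nonempty , dominating , separating) =
      nonempty-pullback nonempty , dominating-pullback dominating , separating′
      where
      separating′ : ∀ p q → D p ≡ false → D q ≡ false → p ≢ q → ¬ SameI G D p q
      separating′ p q p∉D q∉D p≢q with φ p ≟ φ q
      ... | yes φp≡φq = distinguishes⇒¬SameI {G = G} {C = D} (fibres-distinguished dominating p≢q φp≡φq)
      ... | no φp≢φq = separating _ _ p∉D q∉D φp≢φq ∘ SameI-preserved

    self-identifying-pullback : (∀ u → ∃ λ v → u ≢ v) → SelfIdentifying H C → SelfIdentifying G D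
    self-identifying-pullback other self-identifying@(nonempty , distinguishing) =
      nonempty-pullback nonempty , distinguishing′
      where
      distinguishing′ : ∀ p q → p ≢ q → Distinguishes G D p q
      distinguishing′ p q p≢q with φ p ≟ φ q
      ... | yes φp≡φq = fibres-distinguished (self-identifying⇒dominating other self-identifying) p≢q φp≡φq
      ... | no φp≢φq = distinguishes-lifts (distinguishing _ _ φp≢φq)

offset-difference : ∀ {a b u v} t → a ℤ.+ u ≡ b ℤ.+ v → (a ℤ.+ t) ℤ.- b ≡ (t ℤ.+ v) ℤ.- u
offset-difference {a} {b} {u} {v} t a+u≡b+v = begin
  (a ℤ.+ t) ℤ.- b                                   ≡⟨ regroup a b t u v ⟩
  ((t ℤ.+ v) ℤ.- u) ℤ.+ ((a ℤ.+ u) ℤ.- (b ℤ.+ v))   ≡⟨ cong (λ e → (t ℤ.+ v) ℤ.- u ℤ.+ (e ℤ.- (b ℤ.+ v))) a+u≡b+v ⟩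
  ((t ℤ.+ v) ℤ.- u) ℤ.+ ((b ℤ.+ v) ℤ.- (b ℤ.+ v))   ≡⟨ cong (λ e → (t ℤ.+ v) ℤ.- u ℤ.+ e) (ℤP.+-inverseʳ (b ℤ.+ v)) ⟩
  ((t ℤ.+ v) ℤ.- u) ℤ.+ 0ℤ                          ≡⟨ ℤP.+-identityʳ _ ⟩
  (t ℤ.+ v) ℤ.- u                                   ∎
  where
  open ≡-Reasoning
  regroup : ∀ a b t u v → (a ℤ.+ t) ℤ.- b ≡ ((t ℤ.+ v) ℤ.- u) ℤ.+ ((a ℤ.+ u) ℤ.- (b ℤ.+ v))
  regroup = solve-∀

data Step : Set where
  stay east west north south northeast southwest : Step

step : Step → ℤ × ℤ
step stay      = 0ℤ , 0ℤ
step east      = 1ℤ , 0ℤ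
step west      = - 1ℤ , 0ℤ
step north     = 0ℤ , 1ℤ
step south     = 0ℤ , - 1ℤ
step northeast = 1ℤ , 1ℤ
step southwest = - 1ℤ , - 1ℤ

infixl 6 _+ₚ_

_+ₚ_ : ℤ × ℤ → ℤ × ℤ → ℤ × ℤ
p +ₚ v = proj₁ p ℤ.+ proj₁ v , proj₂ p ℤ.+ proj₂ v

+ₚ-cancelʳ : ∀ {p q} v → p +ₚ v ≡ q +ₚ v → p ≡ q
+ₚ-cancelʳ v eq = cong₂ _,_ (+-cancelʳ (proj₁ v) _ _ (cong proj₁ eq)) (+-cancelʳ (proj₂ v) _ _ (cong proj₂ eq))

triangular? : ∀ p q → Dec (N Triangular p q)
triangular? (x , y) (x′ , y′) =
  (∣ x ℤ.- x′ ∣ ℕ.+ ∣ y ℤ.- y′ ∣ ℕ.≤? 1) ⊎-dec ((x′ , y′) ≟ₚ _) ⊎-dec ((x′ , y′) ≟ₚ _)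
  where
  _≟ₚ_ : DecidableEquality (ℤ × ℤ)
  _≟ₚ_ = ≡-dec ℤ._≟_ ℤ._≟_

-- Stated for the offsets a = x - x′ and b = y - y′ as they occur in the definition of the grid.
unit-offset-step : ∀ a b → ∣ a ∣ ℕ.+ ∣ b ∣ ≤ 1 → ∃ λ s → step s ≡ (- a , - b)
unit-offset-step (+ 0)      (+ 0)      _ = stay , refl
unit-offset-step (+ 0)      (+ 1)      _ = south , refl
unit-offset-step (+ 0)      -[1+ 0 ]   _ = north , refl
unit-offset-step (+ 1)      (+ 0)      _ = west , refl
unit-offset-step -[1+ 0 ]   (+ 0)      _ = east , refl
unit-offset-step (+ 0)      (+ suc (suc _)) (s≤s ())
unit-offset-step (+ 0)      -[1+ suc _ ]    (s≤s ())
unit-offset-step (+ 1)      (+ suc _)       (s≤s ())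
unit-offset-step (+ 1)      -[1+ _ ]        (s≤s ())
unit-offset-step (+ suc (suc _)) _          (s≤s ())
unit-offset-step -[1+ 0 ]   (+ suc _)       (s≤s ())
unit-offset-step -[1+ 0 ]   -[1+ _ ]        (s≤s ())
unit-offset-step -[1+ suc _ ] _             (s≤s ())

triangular-step : ∀ {p q} → N Triangular p q → ∃ λ s → q ≡ p +ₚ step s
triangular-step {x , y} {x′ , y′} (inj₁ close) with unit-offset-step (x ℤ.- x′) (y ℤ.- y′) close
... | s , step-s = s , trans (cong₂ _,_ (offset x x′) (offset y y′)) (cong ((x , y) +ₚ_) (sym step-s))
  where
  offset : ∀ x x′ → x′ ≡ x ℤ.+ - (x ℤ.- x′)
  offset = solve-∀
triangular-step (inj₂ (inj₁ q≡p+[1,1])) = northeast , q≡p+[1,1]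
triangular-step (inj₂ (inj₂ q≡p-[1,1])) = southwest , q≡p-[1,1]

step-triangular : ∀ p s → N Triangular p (p +ₚ step s)
step-triangular (x , y) s = adjacent s
  where
  offset : ∀ x v → x ℤ.- (x ℤ.+ v) ≡ - v
  offset = solve-∀
  adjacent : ∀ s → N Triangular (x , y) ((x , y) +ₚ step s)
  adjacent stay      rewrite offset x 0ℤ   | offset y 0ℤ   = inj₁ z≤n
  adjacent east      rewrite offset x 1ℤ   | offset y 0ℤ   = inj₁ ℕP.≤-refl
  adjacent west      rewrite offset x (- 1ℤ) | offset y 0ℤ = inj₁ ℕP.≤-refl
  adjacent north     rewrite offset x 0ℤ   | offset y 1ℤ   = inj₁ ℕP.≤-refl
  adjacent south     rewrite offset x 0ℤ   | offset y (- 1ℤ) = inj₁ ℕP.≤-refl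
  adjacent northeast = inj₂ (inj₁ refl)
  adjacent southwest = inj₂ (inj₂ refl)

step-x-bounded : ∀ s → ∣ proj₁ (step s) ∣ ≤ 1
step-x-bounded stay      = z≤n
step-x-bounded east      = ℕP.≤-refl
step-x-bounded west      = ℕP.≤-refl
step-x-bounded north     = z≤n
step-x-bounded south     = z≤n
step-x-bounded northeast = ℕP.≤-refl
step-x-bounded southwest = ℕP.≤-refl

x-far⇒¬triangular : ∀ {q w} → 1 < ∣ proj₁ w ℤ.- proj₁ q ∣ → ¬ N Triangular q w
x-far⇒¬triangular {q} far q∼w with triangular-step {q} q∼w
... | s , refl = ℕP.<⇒≱ (subst (λ a → 1 < ∣ a ∣) (cancel (proj₁ q) (proj₁ (step s))) far) (step-x-bounded s)
  where
  cancel : ∀ x a → (x ℤ.+ a) ℤ.- x ≡ a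
  cancel = solve-∀

module _ {n : ℕ} {ds : List ℕ} {u v : Fin n} {s : ℕ} (s∈ds : s ∈ ds) where

  circulant-+ : + toℕ v ≡ + toℕ u ℤ.+ + s [mod n ] → N (Circulant n ds) u v
  circulant-+ v≡u+s = inj₂ (s , s∈ds , inj₁ (∣⇒∣ᵤ (divides-difference v≡u+s)))

  circulant-- : + toℕ v ≡ + toℕ u ℤ.- + s [mod n ] → N (Circulant n ds) u v
  circulant-- v≡u-s = inj₂ (s , s∈ds , inj₂ (∣⇒∣ᵤ (divides-difference v≡u-s)))

module Wrap (n c : ℕ) .{{_ : NonZero n}} where

  height : ℤ × ℤ → ℤ
  height p = + c ℤ.* proj₁ p ℤ.+ proj₂ p

  stepHeight : Step → ℤ
  stepHeight stay      = 0ℤ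
  stepHeight east      = + c
  stepHeight west      = - + c
  stepHeight north     = 1ℤ
  stepHeight south     = - 1ℤ
  stepHeight northeast = + suc c
  stepHeight southwest = - + suc c

  private
    times-minus-one : ∀ a → a ℤ.* - 1ℤ ≡ - a
    times-minus-one = solve-∀
    diagonal : ∀ a → a ℤ.* 1ℤ ℤ.+ 1ℤ ≡ 1ℤ ℤ.+ a
    diagonal = solve-∀
    antidiagonal : ∀ a → a ℤ.* - 1ℤ ℤ.+ - 1ℤ ≡ - (1ℤ ℤ.+ a)
    antidiagonal = solve-∀

  height-step : ∀ s → height (step s) ≡ stepHeight s
  height-step stay      = trans (ℤP.+-identityʳ _) (ℤP.*-zeroʳ (+ c))
  height-step east      = trans (ℤP.+-identityʳ _) (ℤP.*-identityʳ (+ c))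
  height-step west      = trans (ℤP.+-identityʳ _) (times-minus-one (+ c))
  height-step north     = cong (ℤ._+ 1ℤ) (ℤP.*-zeroʳ (+ c))
  height-step south     = cong (ℤ._+ - 1ℤ) (ℤP.*-zeroʳ (+ c))
  height-step northeast = trans (diagonal (+ c)) (sym (ℤP.pos-+ 1 c))
  height-step southwest = trans (antidiagonal (+ c)) (cong -_ (sym (ℤP.pos-+ 1 c)))

  height-+step : ∀ p s → height (p +ₚ step s) ≡ height p ℤ.+ stepHeight s
  height-+step p s = trans (linear (+ c) (proj₁ p) (proj₂ p) (proj₁ (step s)) (proj₂ (step s))) (cong (λ h → height p ℤ.+ h) (height-step s))
    where
    linear : ∀ c x y a b → c ℤ.* (x ℤ.+ a) ℤ.+ (y ℤ.+ b) ≡ (c ℤ.* x ℤ.+ y) ℤ.+ (c ℤ.* a ℤ.+ b)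
    linear = solve-∀

  wrap : ℤ × ℤ → Fin n
  wrap = residue n ∘ height

  Cn : Graph
  Cn = Circulant n (1 ∷ c ∷ suc c ∷ [])

  wrap-+step : ∀ p s → + toℕ (wrap (p +ₚ step s)) ≡ + toℕ (wrap p) ℤ.+ stepHeight s [mod n ]
  wrap-+step p s = begin
      + toℕ (wrap (p +ₚ step s))          ≈⟨ residue-≡-mod n _ ⟩
      height (p +ₚ step s)                ≡⟨ height-+step p s ⟩
      height p ℤ.+ stepHeight s           ≈⟨ ≡-mod-+ (≡-mod-sym (residue-≡-mod n (height p))) (≡⇒≡-mod {a = stepHeight s} refl) ⟩
      + toℕ (wrap p) ℤ.+ stepHeight s     ∎
    where open ≡-mod-Reasoning n

  wrap-preserves : ∀ {p q} → N Triangular p q → N Cn (wrap p) (wrap q)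
  wrap-preserves {p} p∼q with triangular-step {p} p∼q
  ... | s , refl = adjacent s
    where
    adjacent : ∀ s → N Cn (wrap p) (wrap (p +ₚ step s))
    adjacent stay      = inj₁ (cong (residue n) (sym (trans (height-+step p stay) (ℤP.+-identityʳ (height p)))))
    adjacent north     = circulant-+ (here refl) (wrap-+step p north)
    adjacent south     = circulant-- (here refl) (wrap-+step p south)
    adjacent east      = circulant-+ (there (here refl)) (wrap-+step p east)
    adjacent west      = circulant-- (there (here refl)) (wrap-+step p west)
    adjacent northeast = circulant-+ (there (there (here refl))) (wrap-+step p northeast)
    adjacent southwest = circulant-- (there (there (here refl))) (wrap-+step p southwest)

  lift-step : ∀ {p w} s → + toℕ w ≡ + toℕ (wrap p) ℤ.+ stepHeight s [mod n ] →
    ∃ λ q → N Triangular p q × wrap q ≡ w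
  lift-step {p} {w} s w≡p+s = p +ₚ step s , step-triangular p s , (begin
      wrap (p +ₚ step s)     ≡⟨ residue-cong n (≡-mod-trans (wrap-height) (≡-mod-sym w≡p+s)) ⟩
      residue n (+ toℕ w)    ≡⟨ residue-toℕ n w ⟩
      w                      ∎)
    where
    open ≡-Reasoning
    wrap-height : height (p +ₚ step s) ≡ + toℕ (wrap p) ℤ.+ stepHeight s [mod n ]
    wrap-height = ≡-mod-trans (≡-mod-sym (residue-≡-mod n (height (p +ₚ step s)))) (wrap-+step p s)

  wrap-lifts : ∀ {p w} → N Cn (wrap p) w → ∃ λ q → N Triangular p q × wrap q ≡ w
  wrap-lifts (inj₁ refl)                                  = lift-step stay (≡⇒≡-mod (sym (ℤP.+-identityʳ _)))
  wrap-lifts (inj₂ (_ , here refl , inj₁ n∣w-p-s))                 = lift-step north (by-divisibility (∣ᵤ⇒∣ n∣w-p-s))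
  wrap-lifts (inj₂ (_ , here refl , inj₂ n∣w-p-s))                 = lift-step south (by-divisibility (∣ᵤ⇒∣ n∣w-p-s))
  wrap-lifts (inj₂ (_ , there (here refl) , inj₁ n∣w-p-s))         = lift-step east (by-divisibility (∣ᵤ⇒∣ n∣w-p-s))
  wrap-lifts (inj₂ (_ , there (here refl) , inj₂ n∣w-p-s))         = lift-step west (by-divisibility (∣ᵤ⇒∣ n∣w-p-s))
  wrap-lifts (inj₂ (_ , there (there (here refl)) , inj₁ n∣w-p-s)) = lift-step northeast (by-divisibility (∣ᵤ⇒∣ n∣w-p-s))
  wrap-lifts (inj₂ (_ , there (there (here refl)) , inj₂ n∣w-p-s)) = lift-step southwest (by-divisibility (∣ᵤ⇒∣ n∣w-p-s))

  wrap-surjective : ∀ v → ∃ λ p → wrap p ≡ v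
  wrap-surjective v = (0ℤ , + toℕ v) , trans (cong (residue n) height-v) (residue-toℕ n v)
    where
    height-v : height (0ℤ , + toℕ v) ≡ + toℕ v
    height-v = trans (cong (ℤ._+ + toℕ v) (ℤP.*-zeroʳ (+ c))) (ℤP.+-identityˡ (+ toℕ v))

  -- Shifted by c + 1, the offsets are 0 < 1 < c < c + 1 < c + 2 < 2c + 1 < 2c + 2 ≤ n.
  module Separation (2≤c : 2 ≤ c) (2[c+1]≤n : suc c ℕ.+ suc c ≤ n) where

    rank : Step → ℕ
    rank southwest = 0
    rank west      = 1
    rank south     = 2
    rank stay      = 3
    rank north     = 4
    rank east      = 5
    rank northeast = 6

    rank-injective : ∀ {s t} → rank s ≡ rank t → s ≡ t
    rank-injective {s} {t} eq = trans (sym (unrank-rank s)) (trans (cong unrank eq) (unrank-rank t))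
      where
      unrank : ℕ → Step
      unrank 0 = southwest
      unrank 1 = west
      unrank 2 = south
      unrank 3 = stay
      unrank 4 = north
      unrank 5 = east
      unrank _ = northeast
      unrank-rank : ∀ s → unrank (rank s) ≡ s
      unrank-rank southwest = refl
      unrank-rank west      = refl
      unrank-rank south     = refl
      unrank-rank stay      = refl
      unrank-rank north     = refl
      unrank-rank east      = refl
      unrank-rank northeast = refl

    rank≤6 : ∀ s → rank s ≤ 6
    rank≤6 southwest = z≤n
    rank≤6 west      = s≤s z≤n
    rank≤6 south     = s≤s (s≤s z≤n)
    rank≤6 stay      = s≤s (s≤s (s≤s z≤n))
    rank≤6 north     = s≤s (s≤s (s≤s (s≤s z≤n)))
    rank≤6 east      = s≤s (s≤s (s≤s (s≤s (s≤s z≤n))))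
    rank≤6 northeast = ℕP.≤-refl

    level : ℕ → ℕ
    level 0 = 0
    level 1 = 1
    level 2 = c
    level 3 = suc c
    level 4 = suc (suc c)
    level 5 = c ℕ.+ suc c
    level _ = suc c ℕ.+ suc c

    level-<-suc : ∀ i → i < 6 → level i < level (suc i)
    level-<-suc 0 _ = ℕP.≤-refl
    level-<-suc 1 _ = 2≤c
    level-<-suc 2 _ = ℕP.n<1+n c
    level-<-suc 3 _ = ℕP.n<1+n (suc c)
    level-<-suc 4 _ = ℕP.+-monoˡ-≤ (suc c) 2≤c
    level-<-suc 5 _ = ℕP.n<1+n (c ℕ.+ suc c)
    level-<-suc (suc (suc (suc (suc (suc (suc _)))))) (s≤s (s≤s (s≤s (s≤s (s≤s (s≤s ()))))))

    level-strictMono : ∀ {i j} → i < j → j ≤ 6 → level i < level j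
    level-strictMono {i} {suc j} (s≤s i≤j) j<7 with ℕP.m≤n⇒m<n∨m≡n i≤j
    ... | inj₁ i<j = ℕP.<-trans (level-strictMono i<j (ℕP.<⇒≤ j<7)) (level-<-suc j j<7)
    ... | inj₂ refl = level-<-suc i j<7

    shifted : Step → ℕ
    shifted = level ∘ rank

    shifted-injective : ∀ {s t} → shifted s ≡ shifted t → s ≡ t
    shifted-injective {s} {t} eq with ℕP.<-cmp (rank s) (rank t)
    ... | tri< s<t _ _ = contradiction eq (ℕP.<⇒≢ (level-strictMono s<t (rank≤6 t)))
    ... | tri≈ _ s≡t _ = rank-injective s≡t
    ... | tri> _ _ t<s = contradiction (sym eq) (ℕP.<⇒≢ (level-strictMono t<s (rank≤6 s)))

    stepHeight-shift : ∀ s → stepHeight s ℤ.+ + suc c ≡ + shifted s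
    stepHeight-shift southwest = ℤP.+-inverseˡ (+ suc c)
    stepHeight-shift west      = trans (cong (λ a → - + c ℤ.+ a) (ℤP.pos-+ 1 c)) (minus-plus-one (+ c))
      where
      minus-plus-one : ∀ a → - a ℤ.+ (1ℤ ℤ.+ a) ≡ 1ℤ
      minus-plus-one = solve-∀
    stepHeight-shift south     = refl
    stepHeight-shift stay      = refl
    stepHeight-shift north     = refl
    stepHeight-shift east      = refl
    stepHeight-shift northeast = refl

    shifted≤ : ∀ s → shifted s ≤ suc c ℕ.+ suc c
    shifted≤ s with ℕP.m≤n⇒m<n∨m≡n (rank≤6 s)
    ... | inj₁ rank<6 = ℕP.<⇒≤ (level-strictMono rank<6 ℕP.≤-refl)
    ... | inj₂ rank≡6 = ℕP.≤-reflexive (cong level rank≡6)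

    shifted≡modulus : ∀ {s} → shifted s ≡ n → s ≡ northeast × n ≡ suc c ℕ.+ suc c
    shifted≡modulus {s} eq = shifted-injective {s} {northeast} top , trans (sym eq) top
      where
      top : shifted s ≡ suc c ℕ.+ suc c
      top = ℕP.≤-antisym (shifted≤ s) (subst (suc c ℕ.+ suc c ≤_) (sym eq) 2[c+1]≤n)

    stepHeight-collision : ∀ {s t} → stepHeight s ≡ stepHeight t [mod n ] →
      s ≡ t ⊎ (s ≡ northeast × t ≡ southwest × n ≡ suc c ℕ.+ suc c)
            ⊎ (t ≡ northeast × s ≡ southwest × n ≡ suc c ℕ.+ suc c)
    stepHeight-collision {s} {t} s≡t
      with ≡-mod-ℕ (bounded s) (bounded t) shifted-congruent
      where
      bounded : ∀ s → shifted s ≤ n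
      bounded s = ℕP.≤-trans (shifted≤ s) 2[c+1]≤n
      shifted-congruent : + shifted s ≡ + shifted t [mod n ]
      shifted-congruent = subst₂ _≡_[mod n ] (stepHeight-shift s) (stepHeight-shift t) (≡-mod-+ s≡t (≡⇒≡-mod refl))
    ... | inj₁ eq = inj₁ (shifted-injective eq)
    ... | inj₂ (inj₁ (s-top , t-bottom)) with shifted≡modulus {s} s-top
    ...   | s≡northeast , n≡2[c+1] = inj₂ (inj₁ (s≡northeast , shifted-injective {t} {southwest} t-bottom , n≡2[c+1]))
    stepHeight-collision {s} {t} s≡t | inj₂ (inj₂ (t-top , s-bottom)) with shifted≡modulus {t} t-top
    ...   | t≡northeast , n≡2[c+1] = inj₂ (inj₂ (t≡northeast , shifted-injective {s} {southwest} s-bottom , n≡2[c+1]))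

    module _ (C : Fin n → Bool) where
      open Pullback {G = Triangular} {H = Cn} wrap wrap-surjective wrap-preserves wrap-lifts C

      -- When p + s = q + t, the point p + t lies at horizontal distance x(t) + x(t) - x(s) from q.
      antipodal-distinguishes : ∀ {p q} s t → p +ₚ step s ≡ q +ₚ step t → D (p +ₚ step s) ≡ true →
        stepHeight t ≡ stepHeight s [mod n ] → 1 < ∣ (proj₁ (step t) ℤ.+ proj₁ (step t)) ℤ.- proj₁ (step s) ∣ →
        Distinguishes Triangular D p q
      antipodal-distinguishes {p} {q} s t p+s≡q+t p+s∈D t≡s far =
        p +ₚ step t , (step-triangular p t , p+t∈D) , x-far⇒¬triangular {q} x-far ∘ proj₁
        where
        heights : height (p +ₚ step t) ≡ height (p +ₚ step s) [mod n ]
        heights = subst₂ _≡_[mod n ] (sym (height-+step p t)) (sym (height-+step p s)) (≡-mod-+ (≡⇒≡-mod {a = height p} refl) t≡s)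
        p+t∈D : D (p +ₚ step t) ≡ true
        p+t∈D = trans (cong C (residue-cong n heights)) p+s∈D
        x-far : 1 < ∣ proj₁ (p +ₚ step t) ℤ.- proj₁ q ∣
        x-far = subst (λ a → 1 < ∣ a ∣) (sym (offset-difference {a = proj₁ p} {b = proj₁ q} (proj₁ (step t)) (cong proj₁ p+s≡q+t))) far

      collision-distinguishes : ∀ {p q} s t → p ≢ q → p +ₚ step s ≡ q +ₚ step t → D (p +ₚ step s) ≡ true →
        s ≡ t ⊎ (s ≡ northeast × t ≡ southwest × n ≡ suc c ℕ.+ suc c)
              ⊎ (t ≡ northeast × s ≡ southwest × n ≡ suc c ℕ.+ suc c) →
        Distinguishes Triangular D p q
      collision-distinguishes s _ p≢q p+s≡q+t _ (inj₁ refl) = contradiction (+ₚ-cancelʳ (step s) p+s≡q+t) p≢q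
      collision-distinguishes {p} {q} _ _ _ p+s≡q+t p+s∈D (inj₂ (inj₁ (refl , refl , n≡2[c+1]))) =
        antipodal-distinguishes {p} {q} northeast southwest p+s≡q+t p+s∈D (minus≡-mod-half n≡2[c+1]) (s≤s (s≤s z≤n))
      collision-distinguishes {p} {q} _ _ _ p+s≡q+t p+s∈D (inj₂ (inj₂ (refl , refl , n≡2[c+1]))) =
        antipodal-distinguishes {p} {q} southwest northeast p+s≡q+t p+s∈D (≡-mod-sym (minus≡-mod-half n≡2[c+1])) (s≤s (s≤s z≤n))

      fibres-distinguished : Dominating Cn C → FibresDistinguished
      fibres-distinguished dominating {p} {q} p≢q wp≡wq with I-lifts (proj₂ (dominating (wrap p)))
      ... | r , (p∼r , r∈D) , _ with triangular? q r
      ... | no ¬q∼r = r , (p∼r , r∈D) , ¬q∼r ∘ proj₁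
      ... | yes q∼r with triangular-step {p} p∼r | triangular-step {q} q∼r
      ... | s , refl | t , p+s≡q+t = collision-distinguishes {p} {q} s t p≢q p+s≡q+t r∈D
        (stepHeight-collision {s} {t} (≡-mod-cancelˡ (residue-≡⇒≡-mod n {height p} {height q} wp≡wq) (≡⇒≡-mod heights)))
        where
        heights : height p ℤ.+ stepHeight s ≡ height q ℤ.+ stepHeight t
        heights = trans (sym (height-+step p s)) (trans (cong height p+s≡q+t) (height-+step q t))

module PeriodicWindows (n : ℕ) .{{_ : NonZero n}} (g : ℤ → ℕ)
  (g≤1 : ∀ a → g a ≤ 1) (g-periodic : ∀ a → g (a ℤ.+ + n) ≡ g a) where

  window : ℤ → ℕ → ℕ
  window a zero    = 0
  window a (suc L) = g a ℕ.+ window (a ℤ.+ 1ℤ) L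

  window-+ : ∀ a L₁ L₂ → window a (L₁ ℕ.+ L₂) ≡ window a L₁ ℕ.+ window (a ℤ.+ + L₁) L₂
  window-+ a zero     L₂ = cong (λ b → window b L₂) (sym (ℤP.+-identityʳ a))
  window-+ a (suc L₁) L₂ = begin
      g a ℕ.+ window (a ℤ.+ 1ℤ) (L₁ ℕ.+ L₂)
    ≡⟨ cong (g a ℕ.+_) (window-+ (a ℤ.+ 1ℤ) L₁ L₂) ⟩
      g a ℕ.+ (window (a ℤ.+ 1ℤ) L₁ ℕ.+ window (a ℤ.+ 1ℤ ℤ.+ + L₁) L₂)
    ≡⟨ sym (ℕP.+-assoc (g a) _ _) ⟩
      window a (suc L₁) ℕ.+ window (a ℤ.+ 1ℤ ℤ.+ + L₁) L₂
    ≡⟨ cong (λ b → window a (suc L₁) ℕ.+ window b L₂) (ℤP.+-assoc a 1ℤ (+ L₁)) ⟩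
      window a (suc L₁) ℕ.+ window (a ℤ.+ + suc L₁) L₂
    ∎
    where open ≡-Reasoning

  window≤length : ∀ a L → window a L ≤ L
  window≤length a zero    = z≤n
  window≤length a (suc L) = ℕP.+-mono-≤ (g≤1 a) (window≤length (a ℤ.+ 1ℤ) L)

  window-slide : ∀ a → window (a ℤ.+ 1ℤ) n ≡ window a n
  window-slide a = ℕP.+-cancelˡ-≡ (g a) _ _ (begin
      window a (suc n)                        ≡⟨ cong (window a) (ℕP.+-comm 1 n) ⟩
      window a (n ℕ.+ 1)                      ≡⟨ window-+ a n 1 ⟩
      window a n ℕ.+ (g (a ℤ.+ + n) ℕ.+ 0)    ≡⟨ cong (window a n ℕ.+_) (trans (ℕP.+-identityʳ _) (g-periodic a)) ⟩
      window a n ℕ.+ g a                      ≡⟨ ℕP.+-comm (window a n) (g a) ⟩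
      g a ℕ.+ window a n                      ∎)
    where open ≡-Reasoning

  window-slide-by : ∀ a j → window (a ℤ.+ + j) n ≡ window a n
  window-slide-by a zero    = cong (λ b → window b n) (ℤP.+-identityʳ a)
  window-slide-by a (suc j) = begin
      window (a ℤ.+ + suc j) n             ≡⟨ cong (λ b → window b n) (trans (cong (λ b → a ℤ.+ b) (ℤP.pos-+ 1 j)) (regroup a (+ j))) ⟩
      window (a ℤ.+ + j ℤ.+ 1ℤ) n          ≡⟨ window-slide (a ℤ.+ + j) ⟩
      window (a ℤ.+ + j) n                 ≡⟨ window-slide-by a j ⟩
      window a n                           ∎
    where
    open ≡-Reasoning
    regroup : ∀ a b → a ℤ.+ (1ℤ ℤ.+ b) ≡ a ℤ.+ b ℤ.+ 1ℤ
    regroup = solve-∀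

  weight : ℕ
  weight = window 0ℤ n

  window-period : ∀ a → window a n ≡ weight
  window-period (+ j)    = window-slide-by 0ℤ j
  window-period -[1+ j ] = trans (sym (window-slide-by -[1+ j ] (suc j))) (cong (λ b → window b n) (ℤP.n⊖n≡0 (suc j)))

  weight≤n : weight ≤ n
  weight≤n = window≤length 0ℤ n

  window-multiple : ∀ q a r → window a (q * n ℕ.+ r) ≡ q * weight ℕ.+ window (a ℤ.+ + (q * n)) r
  window-multiple zero    a r = cong (λ b → window b r) (sym (ℤP.+-identityʳ a))
  window-multiple (suc q) a r = begin
      window a ((n ℕ.+ q * n) ℕ.+ r)
    ≡⟨ cong (window a) (ℕP.+-assoc n (q * n) r) ⟩
      window a (n ℕ.+ (q * n ℕ.+ r))
    ≡⟨ window-+ a n (q * n ℕ.+ r) ⟩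
      window a n ℕ.+ window (a ℤ.+ + n) (q * n ℕ.+ r)
    ≡⟨ cong₂ ℕ._+_ (window-period a) (window-multiple q (a ℤ.+ + n) r) ⟩
      weight ℕ.+ (q * weight ℕ.+ window (a ℤ.+ + n ℤ.+ + (q * n)) r)
    ≡⟨ sym (ℕP.+-assoc weight (q * weight) _) ⟩
      suc q * weight ℕ.+ window (a ℤ.+ + n ℤ.+ + (q * n)) r
    ≡⟨ cong (λ b → suc q * weight ℕ.+ window b r) (ℤP.+-assoc a (+ n) (+ (q * n))) ⟩
      suc q * weight ℕ.+ window (a ℤ.+ + (suc q * n)) r
    ∎
    where open ≡-Reasoning

  private
    euclid : ∀ L → L ≡ L ℕ./ n * n ℕ.+ L ℕ.% n
    euclid L = trans (m≡m%n+[m/n]*n L n) (ℕP.+-comm (L ℕ.% n) _)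
    upper-identity : ∀ n q k t → n * (q * k ℕ.+ t) ≡ k * (q * n) ℕ.+ n * t
    upper-identity = NS.solve-∀
    lower-identity : ∀ n q k r → k * (q * n ℕ.+ r) ≡ n * (q * k) ℕ.+ k * r
    lower-identity = NS.solve-∀

  window-upper : ∀ a L → n * window a L ≤ weight * L ℕ.+ n * n
  window-upper a L = begin
      n * window a L                             ≡⟨ cong (λ l → n * window a l) (euclid L) ⟩
      n * window a (q * n ℕ.+ r)                 ≡⟨ cong (n *_) (window-multiple q a r) ⟩
      n * (q * weight ℕ.+ rest)                  ≡⟨ upper-identity n q weight rest ⟩
      weight * (q * n) ℕ.+ n * rest              ≤⟨ ℕP.+-mono-≤ (ℕP.*-monoʳ-≤ weight (ℕP.m≤m+n (q * n) r)) (ℕP.*-monoʳ-≤ n rest≤n) ⟩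
      weight * (q * n ℕ.+ r) ℕ.+ n * n           ≡⟨ cong (λ l → weight * l ℕ.+ n * n) (sym (euclid L)) ⟩
      weight * L ℕ.+ n * n                       ∎
    where
    open ℕP.≤-Reasoning
    q r rest : ℕ
    q = L ℕ./ n
    r = L ℕ.% n
    rest = window (a ℤ.+ + (q * n)) r
    rest≤n : rest ≤ n
    rest≤n = ℕP.≤-trans (window≤length _ r) (ℕP.<⇒≤ (m%n<n L n))

  window-lower : ∀ a L → weight * L ≤ n * window a L ℕ.+ n * n
  window-lower a L = begin
      weight * L                                 ≡⟨ cong (weight *_) (euclid L) ⟩
      weight * (q * n ℕ.+ r)                     ≡⟨ lower-identity n q weight r ⟩
      n * (q * weight) ℕ.+ weight * r            ≤⟨ ℕP.+-mono-≤ (ℕP.*-monoʳ-≤ n (ℕP.m≤m+n (q * weight) rest)) (ℕP.*-mono-≤ weight≤n (ℕP.<⇒≤ (m%n<n L n))) ⟩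
      n * (q * weight ℕ.+ rest) ℕ.+ n * n        ≡⟨ cong (λ w → n * w ℕ.+ n * n) (sym (window-multiple q a r)) ⟩
      n * window a (q * n ℕ.+ r) ℕ.+ n * n       ≡⟨ cong (λ l → n * window a l ℕ.+ n * n) (sym (euclid L)) ⟩
      n * window a L ℕ.+ n * n                   ∎
    where
    open ℕP.≤-Reasoning
    q r rest : ℕ
    q = L ℕ./ n
    r = L ℕ.% n
    rest = window (a ℤ.+ + (q * n)) r

indicator : Bool → ℕ
indicator b = if b then 1 else 0

indicator≤1 : ∀ b → indicator b ≤ 1
indicator≤1 true  = ℕP.≤-refl
indicator≤1 false = z≤n

sum-concatMap : ∀ {A : Set} (f : A → List ℕ) xs → sum (concatMap f xs) ≡ sum (map (sum ∘ f) xs)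
sum-concatMap f []       = refl
sum-concatMap f (x ∷ xs) = trans (sum-++ (f x) (concatMap f xs)) (cong (sum (f x) ℕ.+_) (sum-concatMap f xs))

module _ {A : Set} (n : ℕ) (r : A → ℕ) where

  scaled-sum-≤ : ∀ U xs → (∀ x → n * r x ≤ U) → n * sum (map r xs) ≤ length xs * U
  scaled-sum-≤ U []       _     = ℕP.≤-reflexive (ℕP.*-zeroʳ n)
  scaled-sum-≤ U (x ∷ xs) bound = begin
      n * (r x ℕ.+ sum (map r xs))         ≡⟨ ℕP.*-distribˡ-+ n (r x) _ ⟩
      n * r x ℕ.+ n * sum (map r xs)       ≤⟨ ℕP.+-mono-≤ (bound x) (scaled-sum-≤ U xs bound) ⟩
      U ℕ.+ length xs * U                  ∎
    where open ℕP.≤-Reasoning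

  scaled-sum-≥ : ∀ U V xs → (∀ x → U ≤ n * r x ℕ.+ V) → length xs * U ≤ n * sum (map r xs) ℕ.+ length xs * V
  scaled-sum-≥ U V []       _     = z≤n
  scaled-sum-≥ U V (x ∷ xs) bound = begin
      U ℕ.+ length xs * U                                              ≤⟨ ℕP.+-mono-≤ (bound x) (scaled-sum-≥ U V xs bound) ⟩
      (n * r x ℕ.+ V) ℕ.+ (n * sum (map r xs) ℕ.+ length xs * V)      ≡⟨ regroup n (r x) V (sum (map r xs)) (length xs * V) ⟩
      n * (r x ℕ.+ sum (map r xs)) ℕ.+ (V ℕ.+ length xs * V)          ∎
    where
    open ℕP.≤-Reasoning
    regroup : ∀ n a V s w → (n * a ℕ.+ V) ℕ.+ (n * s ℕ.+ w) ≡ n * (a ℕ.+ s) ℕ.+ (V ℕ.+ w)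
    regroup = NS.solve-∀

side : ℕ → ℕ
side m = suc (2 * m)

module GridCount (n c : ℕ) .{{_ : NonZero n}} (C : Fin n → Bool) where
  open Wrap n c using (wrap)

  g : ℤ → ℕ
  g = indicator ∘ C ∘ residue n

  g-periodic : ∀ a → g (a ℤ.+ + n) ≡ g a
  g-periodic a = cong (indicator ∘ C) (residue-cong n (subst (λ b → a ℤ.+ + n ≡ b [mod n ]) (ℤP.+-identityʳ a) (≡-mod-+ (≡⇒≡-mod {a = a} refl) modulus≡0)))

  open PeriodicWindows n g (indicator≤1 ∘ C ∘ residue n) g-periodic public

  sum-tabulate≡window : ∀ r (f : Fin r → Fin n) o → (∀ i → toℕ (f i) ≡ o ℕ.+ toℕ i) →
    sum (map (indicator ∘ C) (tabulate f)) ≡ window (+ o) r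
  sum-tabulate≡window zero    f o _         = refl
  sum-tabulate≡window (suc r) f o f-shifted =
    cong₂ ℕ._+_ (cong (indicator ∘ C) f0≡o) (sum-tabulate≡window r (f ∘ Fin.suc) (o ℕ.+ 1) (λ i → trans (f-shifted (Fin.suc i)) (sym (ℕP.+-assoc o 1 (toℕ i)))))
    where
    f0≡o : f Fin.zero ≡ residue n (+ o)
    f0≡o = trans (sym (residue-toℕ n (f Fin.zero))) (cong (residue n ∘ +_) (trans (f-shifted Fin.zero) (ℕP.+-identityʳ o)))

  count≡weight : count C ≡ weight
  count≡weight = sum-tabulate≡window n (λ i → i) 0 (λ _ → refl)

  sum-applyUpTo≡window : ∀ {A : Set} (h : A → ℕ) (f : ℕ → A) a L → (∀ i → h (f i) ≡ g (a ℤ.+ + i)) →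
    sum (map h (applyUpTo f L)) ≡ window a L
  sum-applyUpTo≡window h f a zero    _        = refl
  sum-applyUpTo≡window h f a (suc L) h∘f≡g =
    cong₂ ℕ._+_ (trans (h∘f≡g 0) (cong g (ℤP.+-identityʳ a)))
      (sum-applyUpTo≡window h (f ∘ suc) (a ℤ.+ 1ℤ) L (λ i → trans (h∘f≡g (suc i)) (cong g (sym (ℤP.+-assoc a 1ℤ (+ i))))))

  row : ℕ → ℤ → ℕ
  row m x = sum (map (λ y → indicator (C (wrap (x , y)))) (range m))

  row≡window : ∀ m x → row m x ≡ window (+ c ℤ.* x ℤ.- + m) (side m)
  row≡window m x = trans (cong sum (sym (ListP.map-∘ (upTo (side m)))))
    (sum-applyUpTo≡window _ (λ i → i) (+ c ℤ.* x ℤ.- + m) (side m) (λ i → cong g (regroup (+ c ℤ.* x) (+ i) (+ m))))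
    where
    regroup : ∀ a i m → a ℤ.+ (i ℤ.- m) ≡ (a ℤ.- m) ℤ.+ i
    regroup = solve-∀

  countQ≡sum-rows : ∀ m → countQ (C ∘ wrap) m ≡ sum (map (row m) (range m))
  countQ≡sum-rows m = sum-concatMap (λ x → map (λ y → indicator (C (wrap (x , y)))) (range m)) (range m)

  length-range : ∀ m → length (range m) ≡ side m
  length-range m = trans (ListP.length-map _ (upTo (side m))) (ListP.length-applyUpTo (λ i → i) (side m))

  countQ-upper : ∀ m → n * countQ (C ∘ wrap) m ≤ side m * (weight * side m ℕ.+ n * n)
  countQ-upper m = subst₂ (λ total rows → n * total ≤ rows * (weight * side m ℕ.+ n * n)) (sym (countQ≡sum-rows m)) (length-range m)
    (scaled-sum-≤ n (row m) _ (range m) (λ x → subst (λ w → n * w ≤ weight * side m ℕ.+ n * n) (sym (row≡window m x)) (window-upper (+ c ℤ.* x ℤ.- + m) (side m))))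

  countQ-lower : ∀ m → side m * (weight * side m) ≤ n * countQ (C ∘ wrap) m ℕ.+ side m * (n * n)
  countQ-lower m = subst₂ (λ total rows → rows * (weight * side m) ≤ n * total ℕ.+ rows * (n * n)) (sym (countQ≡sum-rows m)) (length-range m)
    (scaled-sum-≥ n (row m) _ (n * n) (range m) (λ x → subst (λ w → weight * side m ≤ n * w ℕ.+ n * n) (sym (row≡window m x)) (window-lower (+ c ℤ.* x ℤ.- + m) (side m))))

difference-< : ∀ {A B C} → A < C ℕ.+ B → + A ℤ.- + B ℤ.< + C
difference-< {A} {B} {C} A<C+B = subst (λ x → + A ℤ.- + B ℤ.< x) (cancel (+ C) (+ B)) (ℤP.+-monoˡ-< (- + B) (ℤ.+<+ A<C+B))
  where
  cancel : ∀ c b → c ℤ.+ b ℤ.- b ≡ c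
  cancel = solve-∀

side²≡size : ∀ m → side m * side m ≡ suc (sizeQ-1 m)
side²≡size m = square m
  where
  square : ∀ m → suc (2 * m) * suc (2 * m) ≡ suc ((2 * m) * (2 * m) ℕ.+ 4 * m)
  square = NS.solve-∀

-- Both bounds say that the count in Q_m is (k / n) |Q_m| up to an error n · side m.
module DensityFromBounds (n′ k : ℕ) (D : ℤ × ℤ → Bool)
  (countQ-upper : ∀ m → suc n′ * countQ D m ≤ side m * (k * side m ℕ.+ suc n′ * suc n′))
  (countQ-lower : ∀ m → side m * (k * side m) ≤ suc n′ * countQ D m ℕ.+ side m * (suc n′ * suc n′)) where

  n : ℕ
  n = suc n′

  -- The tolerance is ε = (1 + a) / (1 + b); it is met once n (1 + b) < side m.
  module Tolerance (a b : ℕ) (m : ℕ) (large : n * suc b < side m) where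

    L : ℕ
    L = side m
    Q : ℕ
    Q = countQ D m

    n[1+b]<[1+a]L : n * suc b < suc a * L
    n[1+b]<[1+a]L = ℕP.<-≤-trans large (ℕP.m≤m+n L (a * L))

    scaled-upper : Q * (n * suc b) ≤ (k * suc b ℕ.+ suc a * n) * (L * L)
    scaled-upper = begin
        Q * (n * suc b)                                 ≡⟨ regroup₁ Q n (suc b) ⟩
        (n * Q) * suc b                                 ≤⟨ ℕP.*-monoˡ-≤ (suc b) (countQ-upper m) ⟩
        (L * (k * L ℕ.+ n * n)) * suc b                 ≡⟨ regroup₂ L k n (suc b) ⟩
        (k * suc b) * (L * L) ℕ.+ (n * L) * (n * suc b) ≤⟨ ℕP.+-monoʳ-≤ ((k * suc b) * (L * L)) (ℕP.*-monoʳ-≤ (n * L) (ℕP.<⇒≤ n[1+b]<[1+a]L)) ⟩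
        (k * suc b) * (L * L) ℕ.+ (n * L) * (suc a * L) ≡⟨ regroup₃ L k n (suc b) (suc a) ⟩
        (k * suc b ℕ.+ suc a * n) * (L * L)             ∎
      where
      open ℕP.≤-Reasoning
      regroup₁ : ∀ c n q → c * (n * q) ≡ (n * c) * q
      regroup₁ = NS.solve-∀
      regroup₂ : ∀ L k n q → (L * (k * L ℕ.+ n * n)) * q ≡ (k * q) * (L * L) ℕ.+ (n * L) * (n * q)
      regroup₂ = NS.solve-∀
      regroup₃ : ∀ L k n q e → (k * q) * (L * L) ℕ.+ (n * L) * (e * L) ≡ (k * q ℕ.+ e * n) * (L * L)
      regroup₃ = NS.solve-∀

    scaled-lower : (k * suc b) * (L * L) < Q * (n * suc b) ℕ.+ (suc a * n) * (L * L)
    scaled-lower = begin-strict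
        (k * suc b) * (L * L)                           ≡⟨ regroup₁ L k (suc b) ⟩
        (L * (k * L)) * suc b                           ≤⟨ ℕP.*-monoˡ-≤ (suc b) (countQ-lower m) ⟩
        (n * Q ℕ.+ L * (n * n)) * suc b                 ≡⟨ regroup₂ L Q n (suc b) ⟩
        Q * (n * suc b) ℕ.+ (n * L) * (n * suc b)       <⟨ ℕP.+-monoʳ-< (Q * (n * suc b)) (ℕP.*-monoʳ-< (n * L) {{ℕP.m*n≢0 n L}} n[1+b]<[1+a]L) ⟩
        Q * (n * suc b) ℕ.+ (n * L) * (suc a * L)       ≡⟨ cong (Q * (n * suc b) ℕ.+_) (regroup₃ L n (suc a)) ⟩
        Q * (n * suc b) ℕ.+ (suc a * n) * (L * L)       ∎
      where
      open ℕP.≤-Reasoning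
      regroup₁ : ∀ L k q → (k * q) * (L * L) ≡ (L * (k * L)) * q
      regroup₁ = NS.solve-∀
      regroup₂ : ∀ L c n q → (n * c ℕ.+ L * (n * n)) * q ≡ c * (n * q) ℕ.+ (n * L) * (n * q)
      regroup₂ = NS.solve-∀
      regroup₃ : ∀ L n e → (n * L) * (e * L) ≡ (e * n) * (L * L)
      regroup₃ = NS.solve-∀

    size : ℕ
    size = suc (sizeQ-1 m)

    ratio-≤ : mkℚᵘ (+ Q) (sizeQ-1 m) ℚᵘ.≤ mkℚᵘ (+ k) n′ ℚᵘ.+ mkℚᵘ (+ suc a) b
    ratio-≤ = *≤* (subst₂ ℤ._≤_ (ℤP.pos-* Q (n * suc b)) numerators (ℤ.+≤+ scaled-upper′))
      where
      scaled-upper′ : Q * (n * suc b) ≤ (k * suc b ℕ.+ suc a * n) * size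
      scaled-upper′ = subst (λ s → Q * (n * suc b) ≤ (k * suc b ℕ.+ suc a * n) * s) (side²≡size m) scaled-upper
      numerators : + ((k * suc b ℕ.+ suc a * n) * size) ≡ (+ k ℤ.* + suc b ℤ.+ + suc a ℤ.* + n) ℤ.* + size
      numerators = trans (ℤP.pos-* (k * suc b ℕ.+ suc a * n) size)
        (cong (ℤ._* + size) (trans (ℤP.pos-+ (k * suc b) (suc a * n)) (cong₂ ℤ._+_ (ℤP.pos-* k (suc b)) (ℤP.pos-* (suc a) n))))

    ratio-> : mkℚᵘ (+ k) n′ ℚᵘ.+ mkℚᵘ -[1+ a ] b ℚᵘ.< mkℚᵘ (+ Q) (sizeQ-1 m)
    ratio-> = *<* (subst₂ ℤ._<_ numerators (ℤP.pos-* Q (n * suc b)) (difference-< scaled-lower′))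
      where
      scaled-lower′ : (k * suc b) * size < Q * (n * suc b) ℕ.+ (suc a * n) * size
      scaled-lower′ = subst (λ s → (k * suc b) * s < Q * (n * suc b) ℕ.+ (suc a * n) * s) (side²≡size m) scaled-lower
      factor : ∀ k q e n s → (k ℤ.* q) ℤ.* s ℤ.- (e ℤ.* n) ℤ.* s ≡ (k ℤ.* q ℤ.+ (- e) ℤ.* n) ℤ.* s
      factor = solve-∀
      numerators : + ((k * suc b) * size) ℤ.- + ((suc a * n) * size) ≡ (+ k ℤ.* + suc b ℤ.+ -[1+ a ] ℤ.* + n) ℤ.* + size
      numerators = trans (cong₂ ℤ._-_ (trans (ℤP.pos-* (k * suc b) size) (cong (ℤ._* + size) (ℤP.pos-* k (suc b))))
                                     (trans (ℤP.pos-* (suc a * n) size) (cong (ℤ._* + size) (ℤP.pos-* (suc a) n))))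
                         (factor (+ k) (+ suc b) (+ suc a) (+ n) (+ size))

  density : HasDensity D (+ k / n)
  density (mkℚ (+ zero) _ _)        (ℚ.*<* (ℤ.+<+ ()))
  density (mkℚ -[1+ _ ] _ _)        (ℚ.*<* ())
  density ε@(mkℚ (+ suc a) b _) _ = eventually-below , frequently-above
    where
    threshold : ℕ
    threshold = n * suc b

    large : ∀ m → threshold ≤ m → threshold < side m
    large m threshold≤m = ℕP.≤-<-trans threshold≤m (s≤s (ℕP.m≤m+n m (m ℕ.+ 0)))

    k/n : ℚᵘ
    k/n = mkℚᵘ (+ k) n′

    below : ∀ m → threshold ≤ m → ratio D m ℚ.≤ (+ k / n) ℚ.+ ε
    below m threshold≤m = ℚP.toℚᵘ-cancel-≤ (ℚᵘP.≤-respˡ-≃ (ℚᵘP.≃-sym (ℚP.toℚᵘ-fromℚᵘ _))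
      (ℚᵘP.≤-respʳ-≃ (ℚᵘP.≃-sym bound) (Tolerance.ratio-≤ a b m (large m threshold≤m))))
      where
      bound : toℚᵘ ((+ k / n) ℚ.+ ε) ℚᵘ.≃ k/n ℚᵘ.+ toℚᵘ ε
      bound = ℚᵘP.≃-trans (ℚP.toℚᵘ-homo-+ (+ k / n) ε) (ℚᵘP.+-congˡ (toℚᵘ ε) (ℚP.toℚᵘ-fromℚᵘ k/n))

    above : ∀ m → threshold ≤ m → (+ k / n) ℚ.- ε ℚ.< ratio D m
    above m threshold≤m = ℚP.toℚᵘ-cancel-< (ℚᵘP.<-respˡ-≃ (ℚᵘP.≃-sym bound)
      (ℚᵘP.<-respʳ-≃ (ℚᵘP.≃-sym (ℚP.toℚᵘ-fromℚᵘ _)) (Tolerance.ratio-> a b m (large m threshold≤m))))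
      where
      bound : toℚᵘ ((+ k / n) ℚ.- ε) ℚᵘ.≃ k/n ℚᵘ.+ toℚᵘ (ℚ.- ε)
      bound = ℚᵘP.≃-trans (ℚP.toℚᵘ-homo-+ (+ k / n) (ℚ.- ε)) (ℚᵘP.+-congˡ (toℚᵘ (ℚ.- ε)) (ℚP.toℚᵘ-fromℚᵘ k/n))

    eventually-below : ∃ λ M → ∀ m → M ≤ m → ratio D m ℚ.≤ (+ k / n) ℚ.+ ε
    eventually-below = threshold , below

    frequently-above : ∀ M → ∃ λ m → M ≤ m × (+ k / n) ℚ.- ε ℚ.< ratio D m
    frequently-above M = M ℕ.+ threshold , ℕP.m≤m+n M threshold , above (M ℕ.+ threshold) (ℕP.m≤n+m threshold M)

another : ∀ {m} → 2 ≤ m → (u : Fin m) → ∃ λ v → u ≢ v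
another (s≤s (s≤s _)) Fin.zero    = Fin.suc Fin.zero , λ ()
another (s≤s (s≤s _)) (Fin.suc _) = Fin.zero , λ ()

theorem2 : (n d : ℕ) → .{{_ : NonZero n}} → 3 ≤ d → 2 * d ≤ n →
    (C : Fin n → Bool) →
      (Identifying (Circulant n (1 ∷ d ∸ 1 ∷ d ∷ [])) C →
        ∃ λ (D : _ → Bool) → Identifying Triangular D × HasDensity D ((+ count C) / n))
    × (LocatingDominating (Circulant n (1 ∷ d ∸ 1 ∷ d ∷ [])) C →
        ∃ λ (D : _ → Bool) → LocatingDominating Triangular D × HasDensity D ((+ count C) / n))
    × (SelfIdentifying (Circulant n (1 ∷ d ∸ 1 ∷ d ∷ [])) C →
        ∃ λ (D : _ → Bool) → SelfIdentifying Triangular D × HasDensity D ((+ count C) / n))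
theorem2 _        zero    ()
theorem2 zero     (suc c) _          ()
theorem2 (suc n′) (suc c) (s≤s 2≤c) 2d≤n C =
    (λ identifying → D , identifying-pullback Fin._≟_ fibres identifying , density)
  , (λ locating → D , locating-dominating-pullback Fin._≟_ fibres locating , density)
  , (λ self-identifying → D , self-identifying-pullback Fin._≟_ fibres (another 2≤n) self-identifying , density)
  where
  n : ℕ
  n = suc n′
  2[c+1]≤n : suc c ℕ.+ suc c ≤ n
  2[c+1]≤n = subst (λ e → suc c ℕ.+ e ≤ n) (ℕP.+-identityʳ (suc c)) 2d≤n
  2≤n : 2 ≤ n
  2≤n = ℕP.≤-trans (ℕP.m≤n⇒m≤1+n 2≤c) (ℕP.≤-trans (ℕP.m≤n+m (suc c) (suc c)) 2[c+1]≤n)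
  open Wrap n c using (Cn; wrap; wrap-surjective; wrap-preserves; wrap-lifts)
  open Pullback {G = Triangular} {H = Cn} wrap wrap-surjective wrap-preserves wrap-lifts C
  open GridCount n c C using (weight; count≡weight; countQ-upper; countQ-lower)
  fibres : Dominating Cn C → FibresDistinguished
  fibres = Wrap.Separation.fibres-distinguished n c 2≤c 2[c+1]≤n C
  density : HasDensity D (+ count C / n)
  density = subst (λ k → HasDensity D (+ k / n)) (sym count≡weight)
    (DensityFromBounds.density n′ weight D countQ-upper countQ-lower)
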